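{- Identify $\mathrm{PGL}_2(\mathbb{Q})$ with the group of Möbius transformations $z\mapsto \frac{pz+q}{rz+s}$ of $\mathbb{P}^1(\mathbb{R})$ with $p,q,r,s\in\mathbb{Q}$ and $ps-qr\neq 0$. Let $K(z)=1-z$, $S(z)=-1/z$, $V(z)=-z$, and for each prime $p$ let $I_p(z)=p/z$. Then the set $\{K,S,V\}\cup\{I_p : p \text{ prime}\}$ generates $\mathrm{PGL}_2(\mathbb{Q})$.
   Context: $\mathrm{PGL}_2(\mathbb{Q})$ is the quotient of the group of invertible $2\times 2$ rational matrices by the nonzero scalar matrices; the matrix $\begin{pmatrix} p&q\\ r&s\end{pmatrix}$ corresponds to the Möbius transformation $z\mapsto \frac{pz+q}{rz+s}$. -}

module Defs where

open import Data.Nat using (ℕ)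
open import Data.Integer using (+_)
open import Data.Rational using (ℚ; _+_; _*_; _-_; -_; 0ℚ; 1ℚ; _/_)
open import Data.Nat.Primality using (Prime)
open import Relation.Binary.PropositionalEquality using (_≡_)
open import Relation.Nullary using (¬_)

-- A 2×2 rational matrix (p q ; r s), representing z ↦ (pz+q)/(rz+s).
record Mat : Set where
  constructor mat
  field
    p q r s : ℚ

open Mat public

det : Mat → ℚ
det (mat a b c d) = a * d - b * c

_·_ : Mat → Mat → Mat
mat a b c d · mat a' b' c' d' =
  mat (a * a' + b * c') (a * b' + b * d') (c * a' + d * c') (c * b' + d * d')

_⊙_ : ℚ → Mat → Mat
λ₀ ⊙ mat a b c d = mat (λ₀ * a) (λ₀ * b) (λ₀ * c) (λ₀ * d)

-- adjugate; for invertible M it equals det(M)·M⁻¹, i.e. the inverse in PGL₂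
adj : Mat → Mat
adj (mat a b c d) = mat d (- b) (- c) a

idM : Mat
idM = mat 1ℚ 0ℚ 0ℚ 1ℚ

ℚof : ℕ → ℚ
ℚof n = + n / 1

Kₘ Sₘ Vₘ : Mat
Kₘ = mat (- 1ℚ) 1ℚ 0ℚ 1ℚ
Sₘ = mat 0ℚ (- 1ℚ) 1ℚ 0ℚ
Vₘ = mat (- 1ℚ) 0ℚ 0ℚ 1ℚ

Iₘ : ℕ → Mat
Iₘ n = mat 0ℚ (ℚof n) 1ℚ 0ℚ

data Generator : Mat → Set where
  genK : Generator Kₘ
  genS : Generator Sₘ
  genV : Generator Vₘ
  genI : (n : ℕ) → Prime n → Generator (Iₘ n)

-- Preimage in GL₂(ℚ) of the subgroup of PGL₂(ℚ) generated by a set of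
-- elements (given by representative matrices): the smallest set of matrices
-- containing the identity and the generators, closed under products,
-- inverses (adjugate = inverse up to a scalar) and nonzero scalar multiples
-- (so it is a union of PGL₂-classes).
data Generated (G : Mat → Set) : Mat → Set where
  g-id  : Generated G idM
  g-gen : ∀ {M} → G M → Generated G M
  g-mul : ∀ {M N} → Generated G M → Generated G N → Generated G (M · N)
  g-inv : ∀ {M} → Generated G M → Generated G (adj M)
  g-scl : ∀ {M} (c : ℚ) → ¬ (c ≡ 0ℚ) → Generated G M → Generated G (c ⊙ M)

{-# OPTIONS --safe #-}
-- A matrix (a b ; c d) with c ≠ 0 is, up to the scalar c, the product of z ↦ z/c, the
-- translation by a, S and the upper triangular matrix (c d ; 0 ad−bc); for c = 0 it is
-- itself upper triangular. Upper triangular matrices are products of dilations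
-- z ↦ xz and translations z ↦ z + y. K V is the translation by 1, and conjugating it
-- by the dilation by x gives the translation by x. I_p V S is the dilation by p and
-- V the dilation by −1, so unique factorisation yields every nonzero dilation.
module Submission where

open import Data.Integer.Base as ℤ using (+_; +[1+_]; -[1+_]; 0ℤ)
import Data.Integer.Properties as ℤ
open import Data.List.Base using (_∷_; [])
open import Data.List.Relation.Unary.All as All using (All)
open import Data.Nat.Base as ℕ using (ℕ; suc)
import Data.Nat.Properties as ℕ
open import Data.Nat.ListAction using (product)
open import Data.Nat.Primality using (Prime)
open import Data.Nat.Primality.Factorisation using (factorise; PrimeFactorisation)
open import Data.Rational.Base
  using (ℚ; mkℚ; 0ℚ; 1ℚ; _+_; _*_; -_; _-_; _/_; 1/_; ↥_; ↧ₙ_; toℚᵘ; NonZero; Positive; ≢-nonZero)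
open import Data.Rational.Properties
  using (+-*-commutativeRing; _≟_; 1≢0; *-assoc; *-comm; *-identityˡ; *-identityʳ; *-inverseˡ; *-inverseʳ;
         *-zeroˡ; *-zeroʳ; ↥p≡0⇒p≡0; toℚᵘ-injective; toℚᵘ-fromℚᵘ; toℚᵘ-homo-*; normalize-pos)
import Data.Rational.Unnormalised.Base as ℚᵘ
import Data.Rational.Unnormalised.Properties as ℚᵘ
open import Level using (0ℓ)
open import Relation.Binary.PropositionalEquality
  using (_≡_; _≢_; refl; sym; trans; cong; subst; module ≡-Reasoning)
open import Relation.Nullary using (¬_; yes; no; contradiction)
open import Relation.Nullary.Decidable using (dec⇒maybe)
open import Tactic.RingSolver using (solve)
open import Tactic.RingSolver.Core.AlmostCommutativeRing using (AlmostCommutativeRing; fromCommutativeRing)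

open import Defs

ℚ-ring : AlmostCommutativeRing 0ℓ 0ℓ
ℚ-ring = fromCommutativeRing +-*-commutativeRing (λ x → dec⇒maybe (0ℚ ≟ x))

*-≢0ˡ : ∀ x y → x * y ≢ 0ℚ → x ≢ 0ℚ
*-≢0ˡ x y xy≢0 refl = xy≢0 (*-zeroˡ y)

*-≢0ʳ : ∀ x y → x * y ≢ 0ℚ → y ≢ 0ℚ
*-≢0ʳ x y xy≢0 refl = xy≢0 (*-zeroʳ x)

1/-≢0 : ∀ x .{{_ : NonZero x}} → 1/ x ≢ 0ℚ
1/-≢0 x 1/x≡0 = 1≢0 (trans (sym (*-inverseʳ x)) (trans (cong (x *_) 1/x≡0) (*-zeroʳ x)))

ℚof-≢0 : ∀ n .{{_ : ℕ.NonZero n}} → ℚof n ≢ 0ℚ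
ℚof-≢0 n ℚof-n≡0 = 0ℚ-not-positive (subst Positive ℚof-n≡0 (normalize-pos n 1))
  where
  0ℚ-not-positive : ¬ Positive 0ℚ
  0ℚ-not-positive ()

ℚof-* : ∀ m n → ℚof (m ℕ.* n) ≡ ℚof m * ℚof n
ℚof-* m n = toℚᵘ-injective (begin
  toℚᵘ (ℚof (m ℕ.* n))                   ≈⟨ toℚᵘ-fromℚᵘ (ℚᵘ.mkℚᵘ (+ (m ℕ.* n)) 0) ⟩
  ℚᵘ.mkℚᵘ (+ (m ℕ.* n)) 0                ≡⟨ cong (λ k → ℚᵘ.mkℚᵘ k 0) (ℤ.pos-* m n) ⟩
  ℚᵘ.mkℚᵘ (+ m) 0 ℚᵘ.* ℚᵘ.mkℚᵘ (+ n) 0   ≈⟨ ℚᵘ.*-cong (toℚᵘ-fromℚᵘ (ℚᵘ.mkℚᵘ (+ m) 0)) (toℚᵘ-fromℚᵘ (ℚᵘ.mkℚᵘ (+ n) 0)) ⟨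
  toℚᵘ (ℚof m) ℚᵘ.* toℚᵘ (ℚof n)         ≈⟨ toℚᵘ-homo-* (ℚof m) (ℚof n) ⟨
  toℚᵘ (ℚof m * ℚof n)                   ∎)
  where open ℚᵘ.≃-Reasoning

*-ℚof-↧ : ∀ x → x * ℚof (↧ₙ x) ≡ ↥ x / 1
*-ℚof-↧ x@(mkℚ n d-1 _) = toℚᵘ-injective (begin
  toℚᵘ (x * ℚof (suc d-1))                 ≈⟨ toℚᵘ-homo-* x (ℚof (suc d-1)) ⟩
  toℚᵘ x ℚᵘ.* toℚᵘ (ℚof (suc d-1))         ≈⟨ ℚᵘ.*-congˡ {toℚᵘ x} (toℚᵘ-fromℚᵘ (ℚᵘ.mkℚᵘ (+ suc d-1) 0)) ⟩
  ℚᵘ.mkℚᵘ n d-1 ℚᵘ.* ℚᵘ.mkℚᵘ (+ suc d-1) 0 ≈⟨ ℚᵘ.*≡* cross-multiplied ⟩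
  ℚᵘ.mkℚᵘ n 0                              ≈⟨ toℚᵘ-fromℚᵘ (ℚᵘ.mkℚᵘ n 0) ⟨
  toℚᵘ (n / 1)                             ∎)
  where
  open ℚᵘ.≃-Reasoning
  cross-multiplied : n ℤ.* + suc d-1 ℤ.* + 1 ≡ n ℤ.* + (suc d-1 ℕ.* 1)
  cross-multiplied = trans (ℤ.*-identityʳ _) (cong (λ k → n ℤ.* + k) (sym (ℕ.*-identityʳ (suc d-1))))

open ≡-Reasoning

mat-cong : ∀ {a b c d a′ b′ c′ d′} → a ≡ a′ → b ≡ b′ → c ≡ c′ → d ≡ d′ →
           mat a b c d ≡ mat a′ b′ c′ d′
mat-cong refl refl refl refl = refl

dilation translation : ℚ → Mat
dilation x = mat x 0ℚ 0ℚ 1ℚ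
translation y = mat 1ℚ y 0ℚ 1ℚ

upper : ℚ → ℚ → ℚ → Mat
upper a b d = mat a b 0ℚ d

⊙-assoc : ∀ x y M → x ⊙ (y ⊙ M) ≡ (x * y) ⊙ M
⊙-assoc x y (mat a b c d) =
  mat-cong (sym (*-assoc x y a)) (sym (*-assoc x y b)) (sym (*-assoc x y c)) (sym (*-assoc x y d))

⊙-identityˡ : ∀ M → 1ℚ ⊙ M ≡ M
⊙-identityˡ (mat a b c d) = mat-cong (*-identityˡ a) (*-identityˡ b) (*-identityˡ c) (*-identityˡ d)

-- The products are unfolded by hand (≡⟨⟩) because the ring solver treats the entries
-- of an unreduced matrix product as opaque atoms.
dilation-· : ∀ x a b c d → dilation x · mat a b c d ≡ mat (x * a) (x * b) c d
dilation-· x a b c d = begin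
  dilation x · mat a b c d
    ≡⟨⟩
  mat (x * a + 0ℚ * c) (x * b + 0ℚ * d) (0ℚ * a + 1ℚ * c) (0ℚ * b + 1ℚ * d)
    ≡⟨ mat-cong (solve (x ∷ a ∷ c ∷ []) ℚ-ring) (solve (x ∷ b ∷ d ∷ []) ℚ-ring)
                (solve (a ∷ c ∷ []) ℚ-ring) (solve (b ∷ d ∷ []) ℚ-ring) ⟩
  mat (x * a) (x * b) c d ∎

adj-dilation-· : ∀ x a b c d → adj (dilation x) · mat a b c d ≡ mat a b (x * c) (x * d)
adj-dilation-· x a b c d = begin
  adj (dilation x) · mat a b c d
    ≡⟨⟩
  mat (1ℚ * a + - 0ℚ * c) (1ℚ * b + - 0ℚ * d) (- 0ℚ * a + x * c) (- 0ℚ * b + x * d)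
    ≡⟨ mat-cong (solve (a ∷ c ∷ []) ℚ-ring) (solve (b ∷ d ∷ []) ℚ-ring)
                (solve (x ∷ a ∷ c ∷ []) ℚ-ring) (solve (x ∷ b ∷ d ∷ []) ℚ-ring) ⟩
  mat a b (x * c) (x * d) ∎

·-dilation : ∀ a b c d x → mat a b c d · dilation x ≡ mat (a * x) b (c * x) d
·-dilation a b c d x = begin
  mat a b c d · dilation x
    ≡⟨⟩
  mat (a * x + b * 0ℚ) (a * 0ℚ + b * 1ℚ) (c * x + d * 0ℚ) (c * 0ℚ + d * 1ℚ)
    ≡⟨ mat-cong (solve (a ∷ b ∷ x ∷ []) ℚ-ring) (solve (a ∷ b ∷ []) ℚ-ring)
                (solve (c ∷ d ∷ x ∷ []) ℚ-ring) (solve (c ∷ d ∷ []) ℚ-ring) ⟩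
  mat (a * x) b (c * x) d ∎

·-adj-dilation : ∀ a b c d x → mat a b c d · adj (dilation x) ≡ mat a (b * x) c (d * x)
·-adj-dilation a b c d x = begin
  mat a b c d · adj (dilation x)
    ≡⟨⟩
  mat (a * 1ℚ + b * - 0ℚ) (a * - 0ℚ + b * x) (c * 1ℚ + d * - 0ℚ) (c * - 0ℚ + d * x)
    ≡⟨ mat-cong (solve (a ∷ b ∷ []) ℚ-ring) (solve (a ∷ b ∷ x ∷ []) ℚ-ring)
                (solve (c ∷ d ∷ []) ℚ-ring) (solve (c ∷ d ∷ x ∷ []) ℚ-ring) ⟩
  mat a (b * x) c (d * x) ∎

translation-· : ∀ y a b c d → translation y · mat a b c d ≡ mat (a + y * c) (b + y * d) c d
translation-· y a b c d = begin
  translation y · mat a b c d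
    ≡⟨⟩
  mat (1ℚ * a + y * c) (1ℚ * b + y * d) (0ℚ * a + 1ℚ * c) (0ℚ * b + 1ℚ * d)
    ≡⟨ mat-cong (solve (y ∷ a ∷ c ∷ []) ℚ-ring) (solve (y ∷ b ∷ d ∷ []) ℚ-ring)
                (solve (a ∷ c ∷ []) ℚ-ring) (solve (b ∷ d ∷ []) ℚ-ring) ⟩
  mat (a + y * c) (b + y * d) c d ∎

S-· : ∀ a b c d → Sₘ · mat a b c d ≡ mat (- c) (- d) a b
S-· a b c d = begin
  Sₘ · mat a b c d
    ≡⟨⟩
  mat (0ℚ * a + - 1ℚ * c) (0ℚ * b + - 1ℚ * d) (1ℚ * a + 0ℚ * c) (1ℚ * b + 0ℚ * d)
    ≡⟨ mat-cong (solve (a ∷ c ∷ []) ℚ-ring) (solve (b ∷ d ∷ []) ℚ-ring)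
                (solve (a ∷ c ∷ []) ℚ-ring) (solve (b ∷ d ∷ []) ℚ-ring) ⟩
  mat (- c) (- d) a b ∎

-- V S is z ↦ 1/z.
inversion·V·S : ∀ q → mat 0ℚ q 1ℚ 0ℚ · (Vₘ · Sₘ) ≡ dilation q
inversion·V·S q = begin
  mat 0ℚ q 1ℚ 0ℚ · (Vₘ · Sₘ)
    ≡⟨⟩
  mat (0ℚ * 0ℚ + q * 1ℚ) (0ℚ * 1ℚ + q * 0ℚ) 0ℚ 1ℚ
    ≡⟨ mat-cong (solve (q ∷ []) ℚ-ring) (solve (q ∷ []) ℚ-ring) refl refl ⟩
  dilation q ∎

dilation-* : ∀ x y → dilation x · dilation y ≡ dilation (x * y)
dilation-* x y = trans (dilation-· x y 0ℚ 0ℚ 1ℚ) (mat-cong refl (*-zeroʳ x) refl refl)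

·-dilation-·-adj : ∀ M x → (M · dilation x) · adj (dilation x) ≡ x ⊙ M
·-dilation-·-adj (mat a b c d) x = begin
  (mat a b c d · dilation x) · adj (dilation x)   ≡⟨ cong (_· adj (dilation x)) (·-dilation a b c d x) ⟩
  mat (a * x) b (c * x) d · adj (dilation x)      ≡⟨ ·-adj-dilation (a * x) b (c * x) d x ⟩
  mat (a * x) (b * x) (c * x) (d * x)             ≡⟨ mat-cong (*-comm a x) (*-comm b x) (*-comm c x) (*-comm d x) ⟩
  x ⊙ mat a b c d                                 ∎

dilation·translation : ∀ x → dilation x · translation 1ℚ ≡ translation x · dilation x
dilation·translation x = begin
  dilation x · translation 1ℚ   ≡⟨ dilation-· x 1ℚ 1ℚ 0ℚ 1ℚ ⟩
  mat (x * 1ℚ) (x * 1ℚ) 0ℚ 1ℚ   ≡⟨ mat-cong (*-comm x 1ℚ) (*-identityʳ x) (sym (*-zeroˡ x)) refl ⟩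
  mat (1ℚ * x) x (0ℚ * x) 1ℚ    ≡⟨ ·-dilation 1ℚ x 0ℚ 1ℚ x ⟨
  translation x · dilation x    ∎

upper-factorisation : ∀ a b d → adj (dilation d) · (translation b · dilation a) ≡ upper a b d
upper-factorisation a b d = begin
  adj (dilation d) · (translation b · dilation a)   ≡⟨ cong (adj (dilation d) ·_) (·-dilation 1ℚ b 0ℚ 1ℚ a) ⟩
  adj (dilation d) · mat (1ℚ * a) b (0ℚ * a) 1ℚ     ≡⟨ adj-dilation-· d (1ℚ * a) b (0ℚ * a) 1ℚ ⟩
  mat (1ℚ * a) b (d * (0ℚ * a)) (d * 1ℚ)            ≡⟨ mat-cong (*-identityˡ a) refl (solve (d ∷ a ∷ []) ℚ-ring) (*-identityʳ d) ⟩
  upper a b d                                       ∎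

bruhat : ∀ a b c d →
         adj (dilation c) · (translation a · (Sₘ · upper c d (det (mat a b c d)))) ≡ c ⊙ mat a b c d
bruhat a b c d = begin
  adj (dilation c) · (translation a · (Sₘ · upper c d (a * d - b * c)))
    ≡⟨ cong (λ M → adj (dilation c) · (translation a · M)) (S-· c d 0ℚ (a * d - b * c)) ⟩
  adj (dilation c) · (translation a · mat (- 0ℚ) (- (a * d - b * c)) c d)
    ≡⟨ cong (adj (dilation c) ·_) (translation-· a (- 0ℚ) (- (a * d - b * c)) c d) ⟩
  adj (dilation c) · mat (- 0ℚ + a * c) (- (a * d - b * c) + a * d) c d
    ≡⟨ adj-dilation-· c (- 0ℚ + a * c) (- (a * d - b * c) + a * d) c d ⟩
  mat (- 0ℚ + a * c) (- (a * d - b * c) + a * d) (c * c) (c * d)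
    ≡⟨ mat-cong (solve (a ∷ c ∷ []) ℚ-ring) (solve (a ∷ b ∷ c ∷ d ∷ []) ℚ-ring) refl refl ⟩
  c ⊙ mat a b c d ∎

det-upper : ∀ a b d → det (upper a b d) ≡ a * d
det-upper a b d = begin
  det (upper a b d)    ≡⟨⟩
  a * d - b * 0ℚ       ≡⟨ solve (a ∷ b ∷ d ∷ []) ℚ-ring ⟩
  a * d                ∎

module _ {G : Mat → Set} where

  unscale : ∀ {c M} → c ≢ 0ℚ → Generated G (c ⊙ M) → Generated G M
  unscale {c} {M} c≢0 gen[cM] = subst (Generated G) 1/c⊙c⊙M≡M (g-scl (1/ c) (1/-≢0 c) gen[cM])
    where
    instance _ = ≢-nonZero c≢0
    1/c⊙c⊙M≡M : (1/ c) ⊙ (c ⊙ M) ≡ M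
    1/c⊙c⊙M≡M = begin
      (1/ c) ⊙ (c ⊙ M) ≡⟨ ⊙-assoc (1/ c) c M ⟩
      (1/ c * c) ⊙ M   ≡⟨ cong (_⊙ M) (*-inverseˡ c) ⟩
      1ℚ ⊙ M           ≡⟨ ⊙-identityˡ M ⟩
      M                ∎

  cancelʳ-dilation : ∀ {x M} → x ≢ 0ℚ → Generated G (dilation x) → Generated G (M · dilation x) → Generated G M
  cancelʳ-dilation {x} {M} x≢0 gen[x] gen[Mx] =
    unscale x≢0 (subst (Generated G) (·-dilation-·-adj M x) (g-mul gen[Mx] (g-inv gen[x])))

  dilation-÷ : ∀ {x y} → y ≢ 0ℚ → Generated G (dilation y) → Generated G (dilation (x * y)) → Generated G (dilation x)
  dilation-÷ {x} {y} y≢0 gen[y] gen[xy] =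
    cancelʳ-dilation y≢0 gen[y] (subst (Generated G) (sym (dilation-* x y)) gen[xy])

  translation-by-conjugation : ∀ {x} → x ≢ 0ℚ → Generated G (dilation x) → Generated G (translation 1ℚ) →
                               Generated G (translation x)
  translation-by-conjugation {x} x≢0 gen[x] gen[1] =
    cancelʳ-dilation x≢0 gen[x] (subst (Generated G) (dilation·translation x) (g-mul gen[x] gen[1]))

  upper-by-factorisation : ∀ {a b d} → Generated G (dilation a) → Generated G (translation b) →
                           Generated G (dilation d) → Generated G (upper a b d)
  upper-by-factorisation {a} {b} {d} gen[a] gen[b] gen[d] =
    subst (Generated G) (upper-factorisation a b d) (g-mul (g-inv gen[d]) (g-mul gen[b] gen[a]))

translation-one : Generated Generator (translation 1ℚ)
translation-one = g-mul (g-gen genK) (g-gen genV)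

dilation-neg : ∀ {x} → Generated Generator (dilation x) → Generated Generator (dilation (- x))
dilation-neg {x} gen[x] =
  subst (Generated Generator) (trans (dilation-* (- 1ℚ) x) (cong dilation (solve (x ∷ []) ℚ-ring)))
        (g-mul (g-gen genV) gen[x])

dilation-prime : ∀ {p} → Prime p → Generated Generator (dilation (ℚof p))
dilation-prime {p} p-prime =
  subst (Generated Generator) (inversion·V·S (ℚof p)) (g-mul (g-gen (genI p p-prime)) (g-mul (g-gen genV) (g-gen genS)))

dilation-product : ∀ {ps} → All Prime ps → Generated Generator (dilation (ℚof (product ps)))
dilation-product All.[] = g-id
dilation-product {p ∷ ps} (p-prime All.∷ primes) =
  subst (Generated Generator) (trans (dilation-* (ℚof p) (ℚof (product ps))) (cong dilation (sym (ℚof-* p (product ps)))))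
        (g-mul (dilation-prime p-prime) (dilation-product primes))

dilation-ℕ : ∀ n .{{_ : ℕ.NonZero n}} → Generated Generator (dilation (ℚof n))
dilation-ℕ n = subst (λ m → Generated Generator (dilation (ℚof m))) (sym isFactorisation) (dilation-product factorsPrime)
  where open PrimeFactorisation (factorise n)

dilation-ℤ : ∀ i → i ≢ 0ℤ → Generated Generator (dilation (i / 1))
dilation-ℤ (+ 0)      i≢0 = contradiction refl i≢0
dilation-ℤ +[1+ n ]   _   = dilation-ℕ (suc n)
dilation-ℤ -[1+ n ]   _   = dilation-neg (dilation-ℕ (suc n))

dilation-ℚ : ∀ {x} → x ≢ 0ℚ → Generated Generator (dilation x)
dilation-ℚ {x} x≢0 =
  dilation-÷ (ℚof-≢0 (↧ₙ x)) (dilation-ℕ (↧ₙ x))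
    (subst (Generated Generator) (cong dilation (sym (*-ℚof-↧ x))) (dilation-ℤ (↥ x) (λ ↥x≡0 → x≢0 (↥p≡0⇒p≡0 x ↥x≡0))))

translation-ℚ : ∀ x → Generated Generator (translation x)
translation-ℚ x with x ≟ 0ℚ
... | yes refl = g-id
... | no x≢0   = translation-by-conjugation x≢0 (dilation-ℚ x≢0) translation-one

upper-ℚ : ∀ {a b d} → a ≢ 0ℚ → d ≢ 0ℚ → Generated Generator (upper a b d)
upper-ℚ {b = b} a≢0 d≢0 = upper-by-factorisation (dilation-ℚ a≢0) (translation-ℚ b) (dilation-ℚ d≢0)

mainTheorem1 : (M : Mat) → ¬ (det M ≡ 0ℚ) → Generated Generator M
mainTheorem1 (mat a b c d) det≢0 with c ≟ 0ℚ
... | yes refl = upper-ℚ (*-≢0ˡ a d ad≢0) (*-≢0ʳ a d ad≢0)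
  where
  ad≢0 : a * d ≢ 0ℚ
  ad≢0 ad≡0 = det≢0 (trans (det-upper a b d) ad≡0)
... | no c≢0 = unscale c≢0 (subst (Generated Generator) (bruhat a b c d)
  (g-mul (g-inv (dilation-ℚ c≢0)) (g-mul (translation-ℚ a) (g-mul (g-gen genS) (upper-ℚ {b = d} c≢0 det≢0)))))
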